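{- Let $M$ be a finite non-commutative group, equipped with a stable order. Then $N^1(M)=\Omega(n)$.
   Context: A stable order on a monoid is a partial order with $x\leq y$ implying $zx\leq zy$ and $xz\leq yz$; an order ideal is a downward closed subset. For a finite ordered monoid $M$ and order ideal $I$, the evaluation problem $(M,I)$ of length $n$: Alice receives $m_1,m_3,\dots,m_{2n-1}\in M$, Bob receives $m_2,\dots,m_{2n}\in M$, output $1$ iff $m_1\cdots m_{2n}\in I$. $N^1(M)$ is the maximum over order ideals $I$ of the non-deterministic communication complexity of $(M,I)$, as a function of $n$ (minimum over protocols with a common proof string $s$, accepting $1$-inputs for some $s$ and $0$-inputs for no $s$, of the maximum over $1$-inputs of the minimum over accepting $s$ of $|s|$ plus bits communicated). -}

module Defs where

open import Level using (Level; _⊔_)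
open import Data.Bool using (Bool; true; false)
open import Data.Nat using (ℕ; zero; suc; _+_; _*_; _≤_)
open import Data.Fin using (Fin)
open import Data.Vec using (Vec; []; _∷_)
open import Data.List using (List; length)
open import Data.Product using (Σ; ∃; ∃-syntax; _×_; _,_)
open import Relation.Binary using (Rel; IsPartialOrder)
open import Relation.Binary.PropositionalEquality using (_≡_)
open import Relation.Unary using (Pred; _∈_)
open import Relation.Nullary using (¬_)
open import Algebra.Bundles using (Group)

record FiniteOrderedGroup (c ℓ ℓ₂ : Level) : Set (Level.suc (c ⊔ ℓ ⊔ ℓ₂)) where
  field
    group : Group c ℓ
  open Group group public
  field
    size       : ℕ
    enum       : Fin size → Carrier
    enum-onto  : ∀ (x : Carrier) → ∃[ i ] (enum i ≈ x)
    _≤ₘ_           : Rel Carrier ℓ₂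
    isPartialOrder : IsPartialOrder _≈_ _≤ₘ_
    stableˡ        : ∀ {x y} z → x ≤ₘ y → (z ∙ x) ≤ₘ (z ∙ y)
    stableʳ        : ∀ {x y} z → x ≤ₘ y → (x ∙ z) ≤ₘ (y ∙ z)

NonCommutative : ∀ {c ℓ} → Group c ℓ → Set (c ⊔ ℓ)
NonCommutative G = ∃[ x ] ∃[ y ] ¬ (x ∙ y ≈ y ∙ x)
  where open Group G

module _ {c ℓ ℓ₂} (M : FiniteOrderedGroup c ℓ ℓ₂) where
  open FiniteOrderedGroup M

  IsOrderIdeal : Pred Carrier ℓ₂ → Set (c ⊔ ℓ₂)
  IsOrderIdeal I = ∀ {x y} → x ≤ₘ y → y ∈ I → x ∈ I

  -- m₁ m₂ ⋯ m_{2n}, with Alice's vector (m₁,m₃,…) and Bob's (m₂,m₄,…)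
  interleavedProduct : ∀ {n} → Vec Carrier n → Vec Carrier n → Carrier
  interleavedProduct []       []       = ε
  interleavedProduct (a ∷ as) (b ∷ bs) = (a ∙ b) ∙ interleavedProduct as bs

-- Deterministic two-party protocol trees (Alice holds X, Bob holds Y);
-- each internal node is one bit sent by Alice or by Bob.

data Protocol {a} (X Y : Set a) : Set a where
  leaf  : Bool → Protocol X Y
  alice : (X → Bool) → (ifFalse ifTrue : Protocol X Y) → Protocol X Y
  bob   : (Y → Bool) → (ifFalse ifTrue : Protocol X Y) → Protocol X Y

module _ {a} {X Y : Set a} where
  mutual
    output : Protocol X Y → X → Y → Bool
    output (leaf b)      x y = b
    output (alice f p q) x y = output₂ (f x) p q x y
    output (bob g p q)   x y = output₂ (g y) p q x y

    output₂ : Bool → Protocol X Y → Protocol X Y → X → Y → Bool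
    output₂ false p q x y = output p x y
    output₂ true  p q x y = output q x y

  mutual
    bits : Protocol X Y → X → Y → ℕ
    bits (leaf b)      x y = 0
    bits (alice f p q) x y = suc (bits₂ (f x) p q x y)
    bits (bob g p q)   x y = suc (bits₂ (g y) p q x y)

    bits₂ : Bool → Protocol X Y → Protocol X Y → X → Y → ℕ
    bits₂ false p q x y = bits p x y
    bits₂ true  p q x y = bits q x y

-- A non-deterministic protocol: for every proof string s (seen by both
-- players) a deterministic protocol; the input is accepted under s if
-- that protocol outputs 1.
NDProtocol : ∀ {a} → Set a → Set a → Set a
NDProtocol X Y = List Bool → Protocol X Y

module _ {a} {X Y : Set a} where
  Accepts : NDProtocol X Y → X → Y → List Bool → Set
  Accepts P x y s = output (P s) x y ≡ true

  Computes : ∀ {ℓ} → NDProtocol X Y → (X → Y → Set ℓ) → Set (a ⊔ ℓ)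
  Computes P F = (∀ x y → F x y → ∃[ s ] Accepts P x y s)
               × (∀ x y → ¬ F x y → ∀ s → ¬ Accepts P x y s)

  CostAtMost : ∀ {ℓ} → NDProtocol X Y → (X → Y → Set ℓ) → ℕ → Set (a ⊔ ℓ)
  CostAtMost P F k =
    ∀ x y → F x y → ∃[ s ] (Accepts P x y s × length s + bits (P s) x y ≤ k)

module _ {c ℓ ℓ₂} (M : FiniteOrderedGroup c ℓ ℓ₂) where
  open FiniteOrderedGroup M

  EvalProblem : Pred Carrier ℓ₂ → (n : ℕ) → Vec Carrier n → Vec Carrier n → Set ℓ₂
  EvalProblem I n as bs = interleavedProduct M as bs ∈ I

  -- N¹(M)(n) ≥ k : some order ideal I such that every non-deterministic
  -- protocol for (M , I) of length n has cost ≥ k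
  N¹-atLeast : ℕ → ℕ → Set (c ⊔ Level.suc ℓ₂)
  N¹-atLeast n k =
    ∃[ I ] (IsOrderIdeal M I ×
      (∀ (P : NDProtocol (Vec Carrier n) (Vec Carrier n)) →
         Computes P (EvalProblem I n) →
         ∀ k' → CostAtMost P (EvalProblem I n) k' → k ≤ k'))

-- Take non-commuting x, y. Since M is finite, some power h = [x, y] ^ t of their commutator has
-- prime order p, and in a finite stably ordered group g ≤ ε forces g ≈ ε, so for the order ideal
-- {g ≤ ε} a product is accepted exactly when it is trivial. Interleaving blocks of x^±1 and y^±1
-- encodes vectors a, b ∈ (ℤ/p)ᵐ with m = Θ(n) so that the product is h ^ ⟨a, b⟩. A
-- non-deterministic protocol of cost k thus covers the (2p − 1)ᵐ pairs with disjoint supports by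
-- 4 ^ (k + 1) rectangles A × B in which all vectors are orthogonal, and Gaussian elimination gives
-- |A| |B| ≤ pᵐ. Hence 4 ^ (k + 1) ≥ ((2p − 1) / p)ᵐ, i.e. k = Ω(n).

module Submission where

open import Defs
open import Data.Nat
open import Data.Nat.Properties
open import Data.Bool using (Bool; true; false; T; _∧_; _∨_)
open import Data.Bool.Properties using (T?; T-∧; T-∨)
open import Data.Fin using (Fin; zero; suc; toℕ; fromℕ<)
import Data.Fin.Properties as Fin
open import Data.List using (List; []; _∷_; length)
open import Data.List.Properties using (∷-injective)
open import Data.Vec using (Vec; []; _∷_; _++_; head; zipWith; map; replicate; concat)
open import Data.Vec.Properties using (≡-dec)
open import Data.Product using (∃; ∃-syntax; _×_; _,_; proj₁; proj₂)
open import Data.Empty using (⊥-elim)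
open import Data.Sum using (_⊎_; inj₁; inj₂)
open import Data.Nat.DivMod
open import Data.Nat.Divisibility
  using (_∣_; _∣?_; divides; ∣-refl; ∣-reflexive; ∣-trans; n∣m*n; ∣⇒≤; m%n≡0⇒n∣m; n∣m⇒m%n≡0; ∣m∣n⇒∣m+n; ∣m+n∣m⇒∣n; ∣n⇒∣m*n; m∣m*n)
open import Data.Nat.Primality using (Prime; euclidsLemma; prime⇒nonZero; prime⇒irreducible; ¬prime[0]; ¬prime[1])
open import Data.Nat.GCD using (module GCD; module Bézout)
open import Data.Nat.ListAction using (product)
open import Data.Nat.Primality.Factorisation using (PrimeFactorisation; factorise)
open import Data.List.Relation.Unary.All using (All; []; _∷_)
open import Algebra.Bundles using (Group)
open import Function using (_∘_; Injective)
open import Relation.Binary using (IsPartialOrder)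
open import Relation.Binary.PropositionalEquality
  using (_≡_; _≢_; refl; sym; trans; cong; cong₂; subst; module ≡-Reasoning)
open import Relation.Nullary using (¬_; Dec; yes; no; ¬?; _×-dec_)
open import Relation.Nullary.Negation using (¬¬-map)
open import Relation.Nullary.Decidable as Dec using (⌊_⌋; fromWitness; toWitness; ¬¬-excluded-middle)
open import Function.Bundles using (Equivalence)
open import Data.Nat.Tactic.RingSolver using (solve-∀)
open import Algebra.Properties.CommutativeSemigroup +-commutativeSemigroup using (interchange)
open import Algebra.Properties.Semiring.Sum +-*-semiring
  using (sum; sum-syntax; sum-cong-≗; *-distribʳ-sum)

bit : Bool → ℕ
bit false = 0
bit true  = 1

bit≤1 : ∀ b → bit b ≤ 1
bit≤1 false = z≤n
bit≤1 true  = s≤s z≤n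

bit-mono : ∀ {b c} → (T b → T c) → bit b ≤ bit c
bit-mono {false}         _ = z≤n
bit-mono {true}  {true}  _ = ≤-refl
bit-mono {true}  {false} h = ⊥-elim (h _)

¬T⇒bit≡0 : ∀ {b} → ¬ T b → bit b ≡ 0
¬T⇒bit≡0 {false} _  = refl
¬T⇒bit≡0 {true}  ¬T = ⊥-elim (¬T _)

bit-∧ : ∀ b c → bit (b ∧ c) ≡ bit b * bit c
bit-∧ false c = refl
bit-∧ true  c = sym (+-identityʳ (bit c))

sum-mono-≤ : ∀ {n} {f g : Fin n → ℕ} → (∀ i → f i ≤ g i) → sum f ≤ sum g
sum-mono-≤ {zero}  f≤g = z≤n
sum-mono-≤ {suc n} f≤g = +-mono-≤ (f≤g zero) (sum-mono-≤ (f≤g ∘ suc))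

sum-const : ∀ n c → ∑[ i < n ] c ≡ n * c
sum-const zero    c = refl
sum-const (suc n) c = cong (c +_) (sum-const n c)

sum-zero : ∀ {n} {f : Fin n → ℕ} → (∀ i → f i ≡ 0) → sum f ≡ 0
sum-zero {n} f≡0 = trans (sum-cong-≗ f≡0) (trans (sum-const n 0) (*-zeroʳ n))

sum-+ : ∀ {n} (f g : Fin n → ℕ) → ∑[ i < n ] (f i + g i) ≡ sum f + sum g
sum-+ {zero}  f g = refl
sum-+ {suc n} f g = trans (cong (f zero + g zero +_) (sum-+ (f ∘ suc) (g ∘ suc)))
                          (interchange (f zero) (g zero) _ _)

sum-swap : ∀ {m n} (f : Fin m → Fin n → ℕ) →
           ∑[ i < m ] ∑[ j < n ] f i j ≡ ∑[ j < n ] ∑[ i < m ] f i j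
sum-swap {zero} {n} f = sym (sum-zero {n} (λ _ → refl))
sum-swap {suc m} f = trans (cong (sum (f zero) +_) (sum-swap (f ∘ suc)))
                           (sym (sum-+ (f zero) _))

≤-sum : ∀ {n} (f : Fin n → ℕ) i → f i ≤ sum f
≤-sum f zero    = m≤m+n _ _
≤-sum f (suc i) = ≤-trans (≤-sum (f ∘ suc) i) (m≤n+m _ _)

sum-bit-≤1 : ∀ {n} (P : Fin n → Bool) → (∀ i j → T (P i) → T (P j) → i ≡ j) →
             ∑[ i < n ] bit (P i) ≤ 1
sum-bit-≤1 {zero}  P unique = z≤n
sum-bit-≤1 {suc n} P unique with P zero in P₀
... | false = sum-bit-≤1 (P ∘ suc) (λ i j Pi Pj → Fin.suc-injective (unique _ _ Pi Pj))
... | true  = ≤-reflexive (cong suc (sum-zero (λ i → ¬T⇒bit≡0 (λ Pᵢ →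
                  Fin.0≢1+n (unique zero (suc i) (subst T (sym P₀) _) Pᵢ)))))

sum-bit-≤-any : ∀ {n} (P : Fin n → Bool) → (∀ i j → T (P i) → T (P j) → i ≡ j) →
                ∑[ i < n ] bit (P i) ≤ bit ⌊ Fin.any? (T? ∘ P) ⌋
sum-bit-≤-any P unique with Fin.any? (T? ∘ P)
... | yes _ = sum-bit-≤1 P unique
... | no ∄P = ≤-reflexive (sum-zero (λ i → ¬T⇒bit≡0 (λ Pi → ∄P (i , Pi))))

-- Each j is hit by at most one i, so the Kronecker deltas [σ i = j] sum to at most 1 over i.
sum-reindex-≤ : ∀ {m n} (σ : Fin m → Fin n) → Injective _≡_ _≡_ σ → (g : Fin n → ℕ) →
                ∑[ i < m ] g (σ i) ≤ sum g
sum-reindex-≤ {m} {n} σ σ-inj g = begin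
  ∑[ i < m ] g (σ i)                   ≤⟨ sum-mono-≤ (λ i → ≤-trans (diagonal i) (≤-sum (λ j → δ i j * g j) (σ i))) ⟩
  ∑[ i < m ] ∑[ j < n ] (δ i j * g j)  ≡⟨ sum-swap (λ i j → δ i j * g j) ⟩
  ∑[ j < n ] ∑[ i < m ] (δ i j * g j)  ≡⟨ sum-cong-≗ (λ j → *-distribʳ-sum (g j) (λ i → δ i j)) ⟨
  ∑[ j < n ] (∑[ i < m ] δ i j * g j)  ≤⟨ sum-mono-≤ (λ j → *-monoˡ-≤ (g j) (sum-bit-≤1 _ (λ i i′ → hits i i′ j))) ⟩
  ∑[ j < n ] (1 * g j)                 ≡⟨ sum-cong-≗ (λ j → *-identityˡ (g j)) ⟩
  sum g                                ∎
  where
  open ≤-Reasoning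
  δ : Fin m → Fin n → ℕ
  δ i j = bit ⌊ σ i Fin.≟ j ⌋
  diagonal : ∀ i → g (σ i) ≤ δ i (σ i) * g (σ i)
  diagonal i with σ i Fin.≟ σ i
  ... | yes _  = ≤-reflexive (sym (*-identityˡ _))
  ... | no σi≢σi = ⊥-elim (σi≢σi refl)
  hits : ∀ i i′ j → T ⌊ σ i Fin.≟ j ⌋ → T ⌊ σ i′ Fin.≟ j ⌋ → i ≡ i′
  hits i i′ j σi≡j σi′≡j = σ-inj (trans (toWitness σi≡j) (sym (toWitness σi′≡j)))

module _ {p : ℕ} where

  sumVec : ∀ m → (Vec (Fin p) m → ℕ) → ℕ
  sumVec zero    f = f []
  sumVec (suc m) f = ∑[ x < p ] sumVec m (λ v → f (x ∷ v))

  sumVec-cong : ∀ m {f g : Vec (Fin p) m → ℕ} → (∀ v → f v ≡ g v) → sumVec m f ≡ sumVec m g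
  sumVec-cong zero    f≡g = f≡g []
  sumVec-cong (suc m) f≡g = sum-cong-≗ {p} (λ x → sumVec-cong m (λ v → f≡g (x ∷ v)))

  sumVec-mono-≤ : ∀ m {f g : Vec (Fin p) m → ℕ} → (∀ v → f v ≤ g v) → sumVec m f ≤ sumVec m g
  sumVec-mono-≤ zero    f≤g = f≤g []
  sumVec-mono-≤ (suc m) f≤g = sum-mono-≤ {p} (λ x → sumVec-mono-≤ m (λ v → f≤g (x ∷ v)))

  *-distribʳ-sumVec : ∀ m c (f : Vec (Fin p) m → ℕ) → sumVec m f * c ≡ sumVec m (λ v → f v * c)
  *-distribʳ-sumVec zero    c f = refl
  *-distribʳ-sumVec (suc m) c f =
    trans (*-distribʳ-sum {p} c _) (sum-cong-≗ {p} (λ x → *-distribʳ-sumVec m c (λ v → f (x ∷ v))))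

  *-distribˡ-sumVec : ∀ m c (f : Vec (Fin p) m → ℕ) → c * sumVec m f ≡ sumVec m (λ v → c * f v)
  *-distribˡ-sumVec m c f = trans (*-comm c _)
    (trans (*-distribʳ-sumVec m c f) (sumVec-cong m (λ v → *-comm (f v) c)))

  sum-sumVec-swap : ∀ {n} m (f : Fin n → Vec (Fin p) m → ℕ) →
                    ∑[ i < n ] sumVec m (f i) ≡ sumVec m (λ v → ∑[ i < n ] f i v)
  sum-sumVec-swap zero    f = refl
  sum-sumVec-swap (suc m) f = trans (sum-swap (λ i x → sumVec m (λ v → f i (x ∷ v))))
                                    (sum-cong-≗ {p} (λ x → sum-sumVec-swap m (λ i v → f i (x ∷ v))))

  sumVec-* : ∀ m n (f : Vec (Fin p) m → ℕ) (g : Vec (Fin p) n → ℕ) →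
             sumVec m (λ u → sumVec n (λ v → f u * g v)) ≡ sumVec m f * sumVec n g
  sumVec-* m n f g = sym (trans (*-distribʳ-sumVec m _ f)
                                (sumVec-cong m (λ u → *-distribˡ-sumVec n (f u) g)))

  sumVec-zipWith-≤ : ∀ m (σ : Fin p → Fin p → Fin p) → (∀ c → Injective _≡_ _≡_ (λ x → σ x c)) →
                     ∀ t (g : Vec (Fin p) m → ℕ) → sumVec m (λ u → g (zipWith σ u t)) ≤ sumVec m g
  sumVec-zipWith-≤ zero    σ σ-inj []      g = ≤-refl
  sumVec-zipWith-≤ (suc m) σ σ-inj (c ∷ t) g = begin
    ∑[ x < p ] sumVec m (λ u → g (σ x c ∷ zipWith σ u t)) ≤⟨ sum-mono-≤ {p} (λ x → sumVec-zipWith-≤ m σ σ-inj t _) ⟩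
    ∑[ x < p ] sumVec m (λ v → g (σ x c ∷ v))             ≤⟨ sum-reindex-≤ (λ x → σ x c) (σ-inj c) _ ⟩
    ∑[ y < p ] sumVec m (λ v → g (y ∷ v))                 ∎
    where open ≤-Reasoning

module _ (p : ℕ) .{{_ : NonZero p}} where

  %≡%⇒∣∸ : ∀ m n → m % p ≡ n % p → p ∣ n ∸ m
  %≡%⇒∣∸ m n eq = divides (n / p ∸ m / p) (begin
    n ∸ m                                     ≡⟨ cong₂ _∸_ (m≡m%n+[m/n]*n n p) (m≡m%n+[m/n]*n m p) ⟩
    (n % p + n / p * p) ∸ (m % p + m / p * p) ≡⟨ cong (λ r → (n % p + n / p * p) ∸ (r + m / p * p)) eq ⟩
    (n % p + n / p * p) ∸ (n % p + m / p * p) ≡⟨ [m+n]∸[m+o]≡n∸o (n % p) _ _ ⟩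
    n / p * p ∸ m / p * p                     ≡⟨ *-distribʳ-∸ p (n / p) (m / p) ⟨
    (n / p ∸ m / p) * p                       ∎)
    where open ≡-Reasoning

  ∣-resp-% : ∀ {m n} → m % p ≡ n % p → p ∣ m → p ∣ n
  ∣-resp-% {m} {n} eq p∣m = m%n≡0⇒n∣m n p (trans (sym eq) (n∣m⇒m%n≡0 m p p∣m))

  +-%-cong : ∀ {a b c d} → a % p ≡ b % p → c % p ≡ d % p → (a + c) % p ≡ (b + d) % p
  +-%-cong {a} {b} {c} {d} a≡b c≡d = begin
    (a + c) % p           ≡⟨ %-distribˡ-+ a c p ⟩
    (a % p + c % p) % p   ≡⟨ cong₂ (λ x y → (x + y) % p) a≡b c≡d ⟩
    (b % p + d % p) % p   ≡⟨ %-distribˡ-+ b d p ⟨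
    (b + d) % p           ∎
    where open ≡-Reasoning

  *-%-congˡ : ∀ {a b} c → a % p ≡ b % p → (a * c) % p ≡ (b * c) % p
  *-%-congˡ {a} {b} c a≡b = begin
    (a * c) % p           ≡⟨ %-distribˡ-* a c p ⟩
    (a % p * (c % p)) % p ≡⟨ cong (λ x → (x * (c % p)) % p) a≡b ⟩
    (b % p * (c % p)) % p ≡⟨ %-distribˡ-* b c p ⟨
    (b * c) % p           ∎
    where open ≡-Reasoning

  toℕ-mod : ∀ n → toℕ (n mod p) % p ≡ n % p
  toℕ-mod n = trans (cong (_% p) (Fin.toℕ-fromℕ< (m%n<n n p))) (m%n%n≡m%n n p)

∣∧<⇒≡0 : ∀ {p d} → p ∣ d → d < p → d ≡ 0
∣∧<⇒≡0 {d = zero}  _   _   = refl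
∣∧<⇒≡0 {d = suc d} p∣d d<p = ⊥-elim (<⇒≱ d<p (∣⇒≤ p∣d))

module _ {p : ℕ} (p-prime : Prime p) where

  private instance
    p≢0 : NonZero p
    p≢0 = prime⇒nonZero p-prime

  private
    *-+-cancel-%-≤ : ∀ K {α u v} → ¬ p ∣ α → u ≤ v → v < p →
                     (α * u + K) % p ≡ (α * v + K) % p → u ≡ v
    *-+-cancel-%-≤ K {α} {u} {v} p∤α u≤v v<p eq = ≤-antisym u≤v (m∸n≡0⇒m≤n v∸u≡0)
      where
      p∣α[v∸u] : p ∣ α * (v ∸ u)
      p∣α[v∸u] = subst (p ∣_) (begin
        (α * v + K) ∸ (α * u + K) ≡⟨ cong₂ _∸_ (+-comm (α * v) K) (+-comm (α * u) K) ⟩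
        (K + α * v) ∸ (K + α * u) ≡⟨ [m+n]∸[m+o]≡n∸o K (α * v) (α * u) ⟩
        α * v ∸ α * u             ≡⟨ *-distribˡ-∸ α v u ⟨
        α * (v ∸ u)               ∎) (%≡%⇒∣∸ p _ _ eq)
        where open ≡-Reasoning
      v∸u≡0 : v ∸ u ≡ 0
      v∸u≡0 with euclidsLemma α (v ∸ u) p-prime p∣α[v∸u]
      ... | inj₁ p∣α   = ⊥-elim (p∤α p∣α)
      ... | inj₂ p∣v∸u = ∣∧<⇒≡0 p∣v∸u (≤-<-trans (m∸n≤m v u) v<p)

  *-+-cancel-% : ∀ K {α u v} → ¬ p ∣ α → u < p → v < p →
                 (α * u + K) % p ≡ (α * v + K) % p → u ≡ v
  *-+-cancel-% K {u = u} {v} p∤α u<p v<p eq with ≤-total u v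
  ... | inj₁ u≤v = *-+-cancel-%-≤ K p∤α u≤v v<p eq
  ... | inj₂ v≤u = sym (*-+-cancel-%-≤ K p∤α v≤u u<p (sym eq))

module _ {p : ℕ} where

  count : ∀ m → (Vec (Fin p) m → Bool) → ℕ
  count m A = sumVec m (bit ∘ A)

  any-vec? : ∀ m {ℓ} {P : Vec (Fin p) m → Set ℓ} → (∀ v → Dec (P v)) → Dec (∃ P)
  any-vec? zero    P? = Dec.map′ ([] ,_) (λ { ([] , h) → h }) (P? [])
  any-vec? (suc m) P? = Dec.map′ (λ (x , v , h) → x ∷ v , h) (λ { (x ∷ v , h) → x , v , h })
                          (Fin.any? (λ x → any-vec? m (λ v → P? (x ∷ v))))

  tails : ∀ {m} → (Vec (Fin p) (suc m) → Bool) → Vec (Fin p) m → Bool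
  tails A v = ⌊ Fin.any? (λ x → T? (A (x ∷ v))) ⌋

  count-≤-tails : ∀ m A → count (suc m) A ≤ p * count m (tails A)
  count-≤-tails m A = begin
    ∑[ x < p ] sumVec m (λ v → bit (A (x ∷ v)))
      ≤⟨ sum-mono-≤ {p} (λ x → sumVec-mono-≤ m (λ v → bit-mono (λ Axv → fromWitness (x , Axv)))) ⟩
    ∑[ x < p ] count m (tails A) ≡⟨ sum-const p _ ⟩
    p * count m (tails A)        ∎
    where open ≤-Reasoning

  count-≤-tails-unique : ∀ m A → (∀ {x y v} → T (A (x ∷ v)) → T (A (y ∷ v)) → x ≡ y) →
                         count (suc m) A ≤ count m (tails A)
  count-≤-tails-unique m A unique =
    ≤-trans (≤-reflexive (sum-sumVec-swap m (λ x v → bit (A (x ∷ v)))))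
            (sumVec-mono-≤ m (λ v → sum-bit-≤-any (λ x → A (x ∷ v)) (λ _ _ → unique)))

  dot : ∀ {m} → Vec (Fin p) m → Vec (Fin p) m → ℕ
  dot []      []      = 0
  dot (x ∷ u) (y ∷ v) = toℕ x * toℕ y + dot u v

  Orthogonal : ∀ {m} → (A B : Vec (Fin p) m → Bool) → Set
  Orthogonal A B = ∀ a b → T (A a) → T (B b) → p ∣ dot a b

  isZero : Fin p → Bool
  isZero x = toℕ x ≡ᵇ 0

  disjoint : ∀ {m} → Vec (Fin p) m → Vec (Fin p) m → Bool
  disjoint []      []      = true
  disjoint (x ∷ u) (y ∷ v) = (isZero x ∨ isZero y) ∧ disjoint u v

  dot-disjoint : ∀ {m} (a b : Vec (Fin p) m) → T (disjoint a b) → dot a b ≡ 0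
  dot-disjoint []      []      _ = refl
  dot-disjoint (x ∷ u) (y ∷ v) d with Equivalence.to T-∧ d
  ... | x∨y≡0 , u⊥v = cong₂ _+_ (xy≡0 (Equivalence.to T-∨ x∨y≡0)) (dot-disjoint u v u⊥v)
    where
    xy≡0 : T (isZero x) ⊎ T (isZero y) → toℕ x * toℕ y ≡ 0
    xy≡0 (inj₁ x≡0) = cong (_* toℕ y) (≡ᵇ⇒≡ (toℕ x) 0 x≡0)
    xy≡0 (inj₂ y≡0) = trans (cong (toℕ x *_) (≡ᵇ⇒≡ (toℕ y) 0 y≡0)) (*-zeroʳ (toℕ x))

module _ {p₀ : ℕ} where

  private
    p = suc p₀

  sum-isZero-∨ : ∑[ x < p ] ∑[ y < p ] bit (isZero x ∨ isZero y) ≡ p + p₀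
  sum-isZero-∨ = cong₂ _+_ (trans (sum-const p 1) (*-identityʳ p))
                           (trans (sum-cong-≗ {p₀} (λ i → cong suc (sum-zero {p₀} (λ _ → refl))))
                                  (trans (sum-const p₀ 1) (*-identityʳ p₀)))

  count-disjoint : ∀ m → sumVec {p} m (λ a → count m (disjoint {p} a)) ≡ (p + p₀) ^ m
  count-disjoint zero    = refl
  count-disjoint (suc m) = begin
    ∑[ x < p ] sumVec {p} m (λ a → ∑[ y < p ] sumVec {p} m (λ b → bit ((isZero x ∨ isZero y) ∧ disjoint a b)))
      ≡⟨ sum-cong-≗ {p} (λ x → sumVec-cong {p} m (λ a → sum-cong-≗ {p} (λ y →
           trans (sumVec-cong {p} m (λ b → bit-∧ (isZero x ∨ isZero y) (disjoint a b)))
                 (sym (*-distribˡ-sumVec {p} m (bit (isZero x ∨ isZero y)) (bit ∘ disjoint a)))))) ⟩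
    ∑[ x < p ] sumVec {p} m (λ a → ∑[ y < p ] (bit (isZero x ∨ isZero y) * count m (disjoint a)))
      ≡⟨ sum-cong-≗ {p} (λ x → sumVec-cong {p} m (λ a →
           sym (*-distribʳ-sum {p} (count m (disjoint a)) (λ y → bit (isZero x ∨ isZero y))))) ⟩
    ∑[ x < p ] sumVec {p} m (λ a → ∑[ y < p ] bit (isZero x ∨ isZero y) * count m (disjoint a))
      ≡⟨ sum-cong-≗ {p} (λ x → sym (*-distribˡ-sumVec {p} m (∑[ y < p ] bit (isZero x ∨ isZero y)) (count m ∘ disjoint))) ⟩
    ∑[ x < p ] (∑[ y < p ] bit (isZero x ∨ isZero y) * sumVec {p} m (λ a → count m (disjoint a)))
      ≡⟨ *-distribʳ-sum {p} (sumVec {p} m (count m ∘ disjoint)) (λ x → ∑[ y < p ] bit (isZero x ∨ isZero y)) ⟨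
    ∑[ x < p ] ∑[ y < p ] bit (isZero x ∨ isZero y) * sumVec {p} m (λ a → count m (disjoint a))
      ≡⟨ cong₂ _*_ sum-isZero-∨ (count-disjoint m) ⟩
    (p + p₀) * (p + p₀) ^ m ∎
    where open ≡-Reasoning

-- Orthogonal sets of vectors over the field ℤ/p

module _ {p : ℕ} (p-prime : Prime p) where

  private instance
    p≢0 : NonZero p
    p≢0 = prime⇒nonZero p-prime

  lincomb : ∀ {m} → ℕ → ℕ → Vec (Fin p) m → Vec (Fin p) m → Vec (Fin p) m
  lincomb α c = zipWith (λ uᵢ tᵢ → (α * toℕ uᵢ + c * toℕ tᵢ) mod p)

  dot-lincomb : ∀ {m} α c (u t w : Vec (Fin p) m) →
                dot (lincomb α c u t) w % p ≡ (α * dot u w + c * dot t w) % p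
  dot-lincomb α c []       []       []       = cong (_% p) (sym (cong₂ _+_ (*-zeroʳ α) (*-zeroʳ c)))
  dot-lincomb α c (uᵢ ∷ u) (tᵢ ∷ t) (wᵢ ∷ w) = begin
    (toℕ (rᵢ mod p) * toℕ wᵢ + dot (lincomb α c u t) w) % p
      ≡⟨ +-%-cong p (*-%-congˡ p (toℕ wᵢ) (toℕ-mod p rᵢ)) (dot-lincomb α c u t w) ⟩
    (rᵢ * toℕ wᵢ + (α * dot u w + c * dot t w)) % p
      ≡⟨ cong (_% p) (distribute α c (toℕ uᵢ) (toℕ tᵢ) (toℕ wᵢ) (dot u w) (dot t w)) ⟩
    (α * (toℕ uᵢ * toℕ wᵢ + dot u w) + c * (toℕ tᵢ * toℕ wᵢ + dot t w)) % p ∎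
    where
    open ≡-Reasoning
    rᵢ = α * toℕ uᵢ + c * toℕ tᵢ
    distribute : ∀ α c u t w D E →
      (α * u + c * t) * w + (α * D + c * E) ≡ α * (u * w + D) + c * (t * w + E)
    distribute = solve-∀

  module _ {m} {A B : Vec (Fin p) (suc m) → Bool} (A⊥B : Orthogonal A B) where

    tails-orthogonal : (∀ {a} → T (A a) → toℕ (head a) ≡ 0) → Orthogonal (tails A) (tails B)
    tails-orthogonal head≡0 v w Av Bw with toWitness Av | toWitness Bw
    ... | x , Axv | y , Byw =
      subst (λ z → p ∣ z * toℕ y + dot v w) (head≡0 Axv) (A⊥B _ _ Axv Byw)

    -- Gaussian elimination of the first coordinate against a pivot (α ∷ t) ∈ A with α ≠ 0:
    -- (x ∷ u) ↦ α u − x t stays orthogonal to the tails of B, and the head of each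
    -- b ∈ B is determined by its tail.
    module Pivot (α : Fin p) (t : Vec (Fin p) m) (Aαt : T (A (α ∷ t))) (α≢0 : toℕ α ≢ 0) where

      p∤α : ¬ p ∣ toℕ α
      p∤α p∣α = α≢0 (∣∧<⇒≡0 p∣α (Fin.toℕ<n α))

      eliminate : Vec (Fin p) (suc m) → Vec (Fin p) m
      eliminate (x ∷ u) = lincomb (toℕ α) (p ∸ toℕ x) u t

      image : Vec (Fin p) m → Bool
      image v = ⌊ any-vec? (suc m) (λ a → T? (A a) ×-dec ≡-dec Fin._≟_ (eliminate a) v) ⌋

      image-orthogonal : Orthogonal image (tails B)
      image-orthogonal v w Iv Bw with toWitness Iv | toWitness Bw
      ... | (x ∷ u , Axu , refl) | y , Byw =
        ∣-resp-% p (sym (dot-lincomb (toℕ α) c u t w)) p∣E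
        where
        c = p ∸ toℕ x
        E = toℕ α * dot u w + c * dot t w
        c+x≡p : c + toℕ x ≡ p
        c+x≡p = m∸n+n≡m (<⇒≤ (Fin.toℕ<n x))
        combination : ∀ α x y D c T →
          α * (x * y + D) + c * (α * y + T) ≡ (α * D + c * T) + (c + x) * (α * y)
        combination = solve-∀
        p∣E+pαy : p ∣ E + p * (toℕ α * toℕ y)
        p∣E+pαy = subst (p ∣_)
          (trans (combination (toℕ α) (toℕ x) (toℕ y) (dot u w) c (dot t w))
                 (cong (λ z → E + z * (toℕ α * toℕ y)) c+x≡p))
          (∣m∣n⇒∣m+n (∣n⇒∣m*n (toℕ α) (A⊥B _ _ Axu Byw)) (∣n⇒∣m*n c (A⊥B _ _ Aαt Byw)))
        p∣E : p ∣ E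
        p∣E = ∣m+n∣m⇒∣n (subst (p ∣_) (+-comm E _) p∣E+pαy) (m∣m*n _)

      count-≤-image : count (suc m) A ≤ p * count m image
      count-≤-image = begin
        ∑[ x < p ] sumVec m (λ u → bit (A (x ∷ u)))
          ≤⟨ sum-mono-≤ {p} (λ x → sumVec-mono-≤ m (λ u →
               bit-mono (λ Axu → fromWitness (x ∷ u , Axu , refl)))) ⟩
        ∑[ x < p ] sumVec m (λ u → bit (image (eliminate (x ∷ u))))
          ≤⟨ sum-mono-≤ {p} (λ x → sumVec-zipWith-≤ m _ (σ-injective x) t (bit ∘ image)) ⟩
        ∑[ x < p ] count m image ≡⟨ sum-const p _ ⟩
        p * count m image        ∎
        where
        open ≤-Reasoning
        σ-injective : ∀ x c → Injective _≡_ _≡_ (λ uᵢ → (toℕ α * toℕ uᵢ + (p ∸ toℕ x) * toℕ c) mod p)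
        σ-injective x c {uᵢ} {uⱼ} eq = Fin.toℕ-injective
          (*-+-cancel-% p-prime _ p∤α (Fin.toℕ<n uᵢ) (Fin.toℕ<n uⱼ)
             (trans (sym (Fin.toℕ-fromℕ< (m%n<n _ p))) (trans (cong toℕ eq) (Fin.toℕ-fromℕ< (m%n<n _ p)))))

      heads-unique : ∀ {x y w} → T (B (x ∷ w)) → T (B (y ∷ w)) → x ≡ y
      heads-unique {x} {y} {w} Bxw Byw = Fin.toℕ-injective
        (*-+-cancel-% p-prime (dot t w) p∤α (Fin.toℕ<n x) (Fin.toℕ<n y)
          (trans (n∣m⇒m%n≡0 _ p (A⊥B _ _ Aαt Bxw)) (sym (n∣m⇒m%n≡0 _ p (A⊥B _ _ Aαt Byw)))))

  private
    *-≤-p^suc : ∀ m {a a′ b b′} → a ≤ p * a′ → b ≤ b′ → a′ * b′ ≤ p ^ m → a * b ≤ p ^ suc m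
    *-≤-p^suc m {a} {a′} {b} {b′} a≤ b≤ a′b′≤ = begin
      a * b           ≤⟨ *-mono-≤ a≤ b≤ ⟩
      p * a′ * b′     ≡⟨ *-assoc p a′ b′ ⟩
      p * (a′ * b′)   ≤⟨ *-monoʳ-≤ p a′b′≤ ⟩
      p * p ^ m       ∎
      where open ≤-Reasoning

  count-orthogonal : ∀ m (A B : Vec (Fin p) m → Bool) → Orthogonal A B → count m A * count m B ≤ p ^ m
  count-orthogonal zero    A B _   = *-mono-≤ (bit≤1 (A [])) (bit≤1 (B []))
  count-orthogonal (suc m) A B A⊥B with any-vec? (suc m) (λ a → T? (A a) ×-dec ¬? (toℕ (head a) ≟ 0))
  ... | yes (α ∷ t , Aαt , α≢0) =
    *-≤-p^suc m count-≤-image (count-≤-tails-unique m B heads-unique)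
              (count-orthogonal m image (tails B) image-orthogonal)
    where open Pivot A⊥B α t Aαt α≢0
  ... | no ∄pivot = subst (_≤ p ^ suc m) (*-comm (count (suc m) B) _)
    (*-≤-p^suc m (count-≤-tails m B) (count-≤-tails-unique m A heads-unique)
               (subst (_≤ p ^ m) (*-comm (count m (tails A)) _)
                      (count-orthogonal m (tails A) (tails B) (tails-orthogonal A⊥B head≡0))))
    where
    head≡0 : ∀ {a} → T (A a) → toℕ (head a) ≡ 0
    head≡0 {a} Aa = Dec.decidable-stable (toℕ (head a) ≟ 0) (λ a≢0 → ∄pivot (a , Aa , a≢0))
    heads-unique : ∀ {x y v} → T (A (x ∷ v)) → T (A (y ∷ v)) → x ≡ y
    heads-unique Axv Ayv = Fin.toℕ-injective (trans (head≡0 Axv) (sym (head≡0 Ayv)))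

  -- The pairs with a common label form a rectangle rows × columns of orthogonal vectors.
  cover-bound : ∀ m L (label : Vec (Fin p) m → Vec (Fin p) m → ℕ) →
    (∀ a b → T (disjoint a b) → label a b < L) →
    (∀ a b₁ a₂ b → T (disjoint a b₁) → T (disjoint a₂ b) → label a b₁ ≡ label a₂ b → p ∣ dot a b) →
    sumVec m (λ a → count m (disjoint a)) ≤ L * p ^ m
  cover-bound m L label label<L rectangle = begin
    sumVec m (λ a → sumVec m (λ b → bit (disjoint a b)))
      ≤⟨ sumVec-mono-≤ m (λ a → sumVec-mono-≤ m (λ b → in-some-class a b)) ⟩
    sumVec m (λ a → sumVec m (λ b → ∑[ ℓ < L ] bit (class ℓ a b)))
      ≡⟨ sumVec-cong m (λ a → sum-sumVec-swap m (λ ℓ b → bit (class ℓ a b))) ⟨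
    sumVec m (λ a → ∑[ ℓ < L ] sumVec m (λ b → bit (class ℓ a b)))
      ≡⟨ sum-sumVec-swap m (λ ℓ a → sumVec m (λ b → bit (class ℓ a b))) ⟨
    ∑[ ℓ < L ] sumVec m (λ a → sumVec m (λ b → bit (class ℓ a b)))
      ≤⟨ sum-mono-≤ {L} (λ ℓ → sumVec-mono-≤ m (λ a → sumVec-mono-≤ m (λ b → class-⊆-rectangle ℓ a b))) ⟩
    ∑[ ℓ < L ] sumVec m (λ a → sumVec m (λ b → bit (rows ℓ a) * bit (columns ℓ b)))
      ≡⟨ sum-cong-≗ {L} (λ ℓ → sumVec-* m m (bit ∘ rows ℓ) (bit ∘ columns ℓ)) ⟩
    ∑[ ℓ < L ] (count m (rows ℓ) * count m (columns ℓ))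
      ≤⟨ sum-mono-≤ {L} (λ ℓ → count-orthogonal m (rows ℓ) (columns ℓ) (rectangle-orthogonal ℓ)) ⟩
    ∑[ ℓ < L ] (p ^ m)
      ≡⟨ sum-const L (p ^ m) ⟩
    L * p ^ m ∎
    where
    open ≤-Reasoning
    class : Fin L → Vec (Fin p) m → Vec (Fin p) m → Bool
    class ℓ a b = disjoint a b ∧ ⌊ label a b ≟ toℕ ℓ ⌋
    rows columns : Fin L → Vec (Fin p) m → Bool
    rows    ℓ a = ⌊ any-vec? m (λ b → T? (class ℓ a b)) ⌋
    columns ℓ b = ⌊ any-vec? m (λ a → T? (class ℓ a b)) ⌋

    in-some-class : ∀ a b → bit (disjoint a b) ≤ ∑[ ℓ < L ] bit (class ℓ a b)
    in-some-class a b with T? (disjoint a b)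
    ... | no ¬d = ≤-trans (≤-reflexive (¬T⇒bit≡0 ¬d)) z≤n
    ... | yes d = ≤-trans (bit-mono (λ _ → Equivalence.from T-∧ (d , fromWitness (sym (Fin.toℕ-fromℕ< l<L)))))
                          (≤-sum (λ ℓ → bit (class ℓ a b)) (fromℕ< l<L))
      where l<L = label<L a b d

    class-⊆-rectangle : ∀ ℓ a b → bit (class ℓ a b) ≤ bit (rows ℓ a) * bit (columns ℓ b)
    class-⊆-rectangle ℓ a b =
      ≤-trans (bit-mono (λ c → Equivalence.from (T-∧ {rows ℓ a}) (fromWitness (b , c) , fromWitness (a , c))))
              (≤-reflexive (bit-∧ (rows ℓ a) (columns ℓ b)))

    rectangle-orthogonal : ∀ ℓ → Orthogonal (rows ℓ) (columns ℓ)
    rectangle-orthogonal ℓ a b Ra Cb with toWitness Ra | toWitness Cb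
    ... | b₁ , c₁ | a₂ , c₂ with Equivalence.to T-∧ c₁ | Equivalence.to T-∧ c₂
    ... | d₁ , l₁ | d₂ , l₂ = rectangle a b₁ a₂ b d₁ d₂ (trans (toWitness l₁) (sym (toWitness l₂)))

module _ {a} {X Y : Set a} where

  mutual
    trace : Protocol X Y → X → Y → List Bool
    trace (leaf _)      x y = []
    trace (alice f p q) x y = f x ∷ trace₂ (f x) p q x y
    trace (bob g p q)   x y = g y ∷ trace₂ (g y) p q x y

    trace₂ : Bool → Protocol X Y → Protocol X Y → X → Y → List Bool
    trace₂ false p q = trace p
    trace₂ true  p q = trace q

  mutual
    length-trace : ∀ P x y → length (trace P x y) ≡ bits P x y
    length-trace (leaf _)      x y = refl
    length-trace (alice f p q) x y = cong suc (length-trace₂ (f x) p q x y)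
    length-trace (bob g p q)   x y = cong suc (length-trace₂ (g y) p q x y)

    length-trace₂ : ∀ b p q x y → length (trace₂ b p q x y) ≡ bits₂ b p q x y
    length-trace₂ false p q = length-trace p
    length-trace₂ true  p q = length-trace q

  mutual
    output-rectangle : ∀ P {x y x′ y′} → trace P x y ≡ trace P x′ y′ → output P x y′ ≡ output P x y
    output-rectangle (leaf _)      _  = refl
    output-rectangle (alice f p q) {x} {y} {x′} {y′} eq with ∷-injective eq
    ... | fx≡fx′ , rest =
      output₂-rectangle (f x) p q (trans rest (cong (λ b → trace₂ b p q x′ y′) (sym fx≡fx′)))
    output-rectangle (bob g p q)   {x} {y} {x′} {y′} eq with ∷-injective eq
    ... | gy≡gy′ , rest =
      trans (cong (λ b → output₂ b p q x y′) (sym gy≡gy′))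
            (output₂-rectangle (g y) p q (trans rest (cong (λ b → trace₂ b p q x′ y′) (sym gy≡gy′))))

    output₂-rectangle : ∀ b p q {x y x′ y′} → trace₂ b p q x y ≡ trace₂ b p q x′ y′ →
                        output₂ b p q x y′ ≡ output₂ b p q x y
    output₂-rectangle false p q = output-rectangle p
    output₂-rectangle true  p q = output-rectangle q

pair : List Bool → List Bool → List Bool
pair []      t = true ∷ t
pair (b ∷ s) t = false ∷ b ∷ pair s t

pair-injective : ∀ s t s′ t′ → pair s t ≡ pair s′ t′ → s ≡ s′ × t ≡ t′
pair-injective []      t []        t′ refl = refl , refl
pair-injective (b ∷ s) t (b′ ∷ s′) t′ eq with ∷-injective (proj₂ (∷-injective eq))
... | refl , rest with pair-injective s t s′ t′ rest
...   | refl , refl = refl , refl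

length-pair : ∀ s t → length (pair s t) ≤ suc (2 * (length s + length t))
length-pair []      t = s≤s (m≤m+n (length t) _)
length-pair (b ∷ s) t = begin
  suc (suc (length (pair s t)))            ≤⟨ s≤s (s≤s (length-pair s t)) ⟩
  suc (suc (suc (2 * (length s + length t)))) ≡⟨ cong suc (*-suc 2 (length s + length t)) ⟨
  suc (2 * (suc (length s) + length t))    ∎
  where open ≤-Reasoning

code : List Bool → ℕ
code []          = 1
code (false ∷ l) = 2 * code l
code (true  ∷ l) = suc (2 * code l)

code-injective : ∀ l l′ → code l ≡ code l′ → l ≡ l′
code-injective []          []           _  = refl
code-injective []          (false ∷ l′) eq = ⊥-elim (even≢odd (code l′) 0 (sym eq))
code-injective []          (true ∷ l′)  eq = ⊥-elim (code≢0 l′ (*-cancelˡ-≡ (code l′) 0 2 (suc-injective (sym eq))))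
  where
  code≢0 : ∀ l → code l ≢ 0
  code≢0 (false ∷ l) eq = code≢0 l (*-cancelˡ-≡ _ 0 2 eq)
  code≢0 (true ∷ l)  ()
code-injective (false ∷ l) []           eq = ⊥-elim (even≢odd (code l) 0 eq)
code-injective (true ∷ l)  []           eq = sym (code-injective [] (true ∷ l) (sym eq))
code-injective (false ∷ l) (false ∷ l′) eq = cong (false ∷_) (code-injective l l′ (*-cancelˡ-≡ _ _ 2 eq))
code-injective (true ∷ l)  (true ∷ l′)  eq = cong (true ∷_) (code-injective l l′ (*-cancelˡ-≡ _ _ 2 (suc-injective eq)))
code-injective (false ∷ l) (true ∷ l′)  eq = ⊥-elim (even≢odd (code l) (code l′) eq)
code-injective (true ∷ l)  (false ∷ l′) eq = ⊥-elim (even≢odd (code l′) (code l) (sym eq))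

code<2^ : ∀ l → code l < 2 ^ suc (length l)
code<2^ []          = s≤s (s≤s z≤n)
code<2^ (b ∷ l) = begin
  suc (code (b ∷ l))       ≤⟨ s≤s (code-∷-≤ b) ⟩
  suc (suc (2 * code l))   ≡⟨ *-suc 2 (code l) ⟨
  2 * suc (code l)         ≤⟨ *-monoʳ-≤ 2 (code<2^ l) ⟩
  2 * 2 ^ suc (length l)   ∎
  where
  open ≤-Reasoning
  code-∷-≤ : ∀ b → code (b ∷ l) ≤ suc (2 * code l)
  code-∷-≤ false = n≤1+n _
  code-∷-≤ true  = ≤-refl

module GroupProperties {c ℓ} (G : Group c ℓ) where

  open Group G renaming (refl to ≈-refl; sym to ≈-sym; trans to ≈-trans)
  open import Algebra.Properties.Group G using (ε⁻¹≈ε; ⁻¹-involutive; ⁻¹-anti-homo-∙; inverseˡ-unique)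
  open import Algebra.Properties.Monoid.Mult monoid using (×-homo-1; ×-homo-+; ×-assocˡ; ×-congʳ)
  open import Algebra.Definitions.RawMonoid rawMonoid using () renaming (_×_ to _times_)
  open import Relation.Binary.Reasoning.Setoid setoid

  infixr 8 _^ᵍ_

  _^ᵍ_ : Carrier → ℕ → Carrier
  g ^ᵍ n = n times g

  commutator : Carrier → Carrier → Carrier
  commutator g h = (g ∙ h) ∙ (g ⁻¹ ∙ h ⁻¹)

  commutator≈ε⇒comm : ∀ g h → commutator g h ≈ ε → g ∙ h ≈ h ∙ g
  commutator≈ε⇒comm g h [g,h]≈ε = begin
    g ∙ h              ≈⟨ inverseˡ-unique (g ∙ h) (g ⁻¹ ∙ h ⁻¹) [g,h]≈ε ⟩
    (g ⁻¹ ∙ h ⁻¹) ⁻¹   ≈⟨ ⁻¹-anti-homo-∙ (g ⁻¹) (h ⁻¹) ⟩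
    h ⁻¹ ⁻¹ ∙ g ⁻¹ ⁻¹  ≈⟨ ∙-cong (⁻¹-involutive h) (⁻¹-involutive g) ⟩
    h ∙ g              ∎

  commutator-identityˡ : ∀ h → commutator ε h ≈ ε
  commutator-identityˡ h = begin
    (ε ∙ h) ∙ (ε ⁻¹ ∙ h ⁻¹) ≈⟨ ∙-cong (identityˡ h) (≈-trans (∙-congʳ ε⁻¹≈ε) (identityˡ (h ⁻¹))) ⟩
    h ∙ h ⁻¹                ≈⟨ inverseʳ h ⟩
    ε                       ∎

  commutator-identityʳ : ∀ g → commutator g ε ≈ ε
  commutator-identityʳ g = begin
    (g ∙ ε) ∙ (g ⁻¹ ∙ ε ⁻¹) ≈⟨ ∙-cong (identityʳ g) (≈-trans (∙-congˡ ε⁻¹≈ε) (identityʳ (g ⁻¹))) ⟩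
    g ∙ g ⁻¹                ≈⟨ inverseʳ g ⟩
    ε                       ∎

  ε^ᵍ : ∀ n → ε ^ᵍ n ≈ ε
  ε^ᵍ zero    = ≈-refl
  ε^ᵍ (suc n) = ≈-trans (identityˡ _) (ε^ᵍ n)

  ^ᵍ-*-≈ε : ∀ {g} k m → g ^ᵍ m ≈ ε → g ^ᵍ (k * m) ≈ ε
  ^ᵍ-*-≈ε {g} k m gᵐ≈ε = begin
    g ^ᵍ (k * m)   ≈⟨ ×-assocˡ g k m ⟨
    (g ^ᵍ m) ^ᵍ k  ≈⟨ ×-congʳ k gᵐ≈ε ⟩
    ε ^ᵍ k         ≈⟨ ε^ᵍ k ⟩
    ε              ∎

  ^ᵍ-+-≈ε : ∀ {g} d k → g ^ᵍ k ≈ ε → g ^ᵍ (d + k) ≈ g ^ᵍ d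
  ^ᵍ-+-≈ε {g} d k gᵏ≈ε = ≈-trans (×-homo-+ g d k) (≈-trans (∙-congˡ gᵏ≈ε) (identityʳ _))

  ^ᵍ-Bézout : ∀ {g d m n} → g ^ᵍ m ≈ ε → g ^ᵍ n ≈ ε → Bézout.Identity d m n → g ^ᵍ d ≈ ε
  ^ᵍ-Bézout {g} {d} {m} {n} gᵐ≈ε gⁿ≈ε (Bézout.+- a b d+bn≡am) = begin
    g ^ᵍ d           ≈⟨ ^ᵍ-+-≈ε d (b * n) (^ᵍ-*-≈ε b n gⁿ≈ε) ⟨
    g ^ᵍ (d + b * n) ≡⟨ cong (g ^ᵍ_) d+bn≡am ⟩
    g ^ᵍ (a * m)     ≈⟨ ^ᵍ-*-≈ε a m gᵐ≈ε ⟩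
    ε                ∎
  ^ᵍ-Bézout {g} {d} {m} {n} gᵐ≈ε gⁿ≈ε (Bézout.-+ a b d+am≡bn) = begin
    g ^ᵍ d           ≈⟨ ^ᵍ-+-≈ε d (a * m) (^ᵍ-*-≈ε a m gᵐ≈ε) ⟨
    g ^ᵍ (d + a * m) ≡⟨ cong (g ^ᵍ_) d+am≡bn ⟩
    g ^ᵍ (b * n)     ≈⟨ ^ᵍ-*-≈ε b n gⁿ≈ε ⟩
    ε                ∎

  prime-order-∣ : ∀ {g p D} → Prime p → ¬ g ≈ ε → g ^ᵍ p ≈ ε → g ^ᵍ D ≈ ε → p ∣ D
  prime-order-∣ {g} {p} {D} p-prime g≉ε gᵖ≈ε gᴰ≈ε with Bézout.lemma D p
  ... | Bézout.result d gcd identity with prime⇒irreducible p-prime (GCD.gcd∣n gcd)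
  ...   | inj₁ refl = ⊥-elim (g≉ε (≈-trans (≈-sym (×-homo-1 g)) (^ᵍ-Bézout gᴰ≈ε gᵖ≈ε identity)))
  ...   | inj₂ refl = GCD.gcd∣m gcd

  record PrimeOrderPower (g : Carrier) (e : ℕ) : Set ℓ where
    field
      p          : ℕ
      t          : ℕ
      p-prime    : Prime p
      pt∣e       : p * t ∣ e
      nontrivial : ¬ g ^ᵍ t ≈ ε
      order      : (g ^ᵍ t) ^ᵍ p ≈ ε

  PrimeOrderPower-∣ : ∀ {g e e′} → e ∣ e′ → PrimeOrderPower g e → PrimeOrderPower g e′
  PrimeOrderPower-∣ e∣e′ po = record
    { p = p ; t = t ; p-prime = p-prime ; pt∣e = ∣-trans pt∣e e∣e′ ; nontrivial = nontrivial ; order = order }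
    where open PrimeOrderPower po

  -- Walk down the prime factorisation of the order until a power becomes trivial;
  -- since ≈ need not be decidable, the search only succeeds under double negation.
  ¬¬primeOrderPower-factors : ∀ {g} ps → All Prime ps → ¬ g ≈ ε → g ^ᵍ product ps ≈ ε →
                              ¬ ¬ PrimeOrderPower g (product ps)
  ¬¬primeOrderPower-factors {g} []       _                    g≉ε g¹≈ε _ =
    g≉ε (≈-trans (≈-sym (×-homo-1 g)) g¹≈ε)
  ¬¬primeOrderPower-factors {g} (q ∷ ps) (q-prime ∷ ps-prime) g≉ε gᵉ≈ε k =
    ¬¬-excluded-middle λ
      { (yes h≈ε) → ¬¬primeOrderPower-factors ps ps-prime g≉ε h≈ε
                      (k ∘ PrimeOrderPower-∣ (n∣m*n q))
      ; (no h≉ε)  → k (record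
          { p = q ; t = product ps ; p-prime = q-prime ; pt∣e = ∣-refl ; nontrivial = h≉ε
          ; order = ≈-trans (×-assocˡ g q (product ps)) gᵉ≈ε }) }

  ¬¬primeOrderPower : ∀ {g e} → ¬ g ≈ ε → g ^ᵍ suc e ≈ ε → ¬ ¬ PrimeOrderPower g (suc e)
  ¬¬primeOrderPower {g} {e} g≉ε gᵉ≈ε =
    ¬¬-map (PrimeOrderPower-∣ (∣-reflexive (sym isFactorisation)))
      (¬¬primeOrderPower-factors factors factorsPrime g≉ε
         (≈-trans (reflexive (cong (g ^ᵍ_) (sym isFactorisation))) gᵉ≈ε))
    where open PrimeFactorisation (factorise (suc e))

module FiniteOrderedGroupProperties {c ℓ ℓ₂} (M : FiniteOrderedGroup c ℓ ℓ₂) where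

  open FiniteOrderedGroup M renaming (refl to ≈-refl; sym to ≈-sym; trans to ≈-trans)
  open GroupProperties group
  open import Algebra.Properties.Group group using (∙-cancelˡ)
  open import Algebra.Properties.Monoid.Mult monoid using (×-homo-+)
  open import Relation.Binary.Reasoning.Setoid setoid
  private module ≤ₘ = IsPartialOrder isPartialOrder

  finite-order : ∀ g → ∃[ e ] (0 < e × g ^ᵍ e ≈ ε)
  finite-order g with Fin.pigeonhole (n<1+n size) (λ i → proj₁ (enum-onto (g ^ᵍ toℕ i)))
  ... | i , j , i<j , same =
    toℕ j ∸ toℕ i , m<n⇒0<n∸m i<j , ∙-cancelˡ (g ^ᵍ toℕ i) _ _ (begin
      g ^ᵍ toℕ i ∙ g ^ᵍ (toℕ j ∸ toℕ i)  ≈⟨ ×-homo-+ g (toℕ i) _ ⟨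
      g ^ᵍ (toℕ i + (toℕ j ∸ toℕ i))    ≡⟨ cong (g ^ᵍ_) (m+[n∸m]≡n (<⇒≤ i<j)) ⟩
      g ^ᵍ toℕ j                        ≈⟨ proj₂ (enum-onto (g ^ᵍ toℕ j)) ⟨
      enum (index j)                    ≡⟨ cong enum same ⟨
      enum (index i)                    ≈⟨ proj₂ (enum-onto (g ^ᵍ toℕ i)) ⟩
      g ^ᵍ toℕ i                        ≈⟨ identityʳ _ ⟨
      g ^ᵍ toℕ i ∙ ε                    ∎)
    where
    index : Fin (suc size) → Fin size
    index i = proj₁ (enum-onto (g ^ᵍ toℕ i))

  ^ᵍ-≤ε : ∀ {g} → g ≤ₘ ε → ∀ n → (g ^ᵍ n) ≤ₘ ε
  ^ᵍ-≤ε g≤ε zero    = ≤ₘ.refl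
  ^ᵍ-≤ε g≤ε (suc n) = ≤ₘ.trans (stableˡ _ (^ᵍ-≤ε g≤ε n)) (≤ₘ.trans (≤ₘ.reflexive (identityʳ _)) g≤ε)

  -- If g ≤ ε has order n + 1 then ε ≈ g ∙ gⁿ ≤ g ∙ ε ≈ g.
  ≤ε⇒≈ε : ∀ {g} → g ≤ₘ ε → g ≈ ε
  ≤ε⇒≈ε {g} g≤ε with finite-order g
  ... | suc n , _ , gⁿ⁺¹≈ε = ≤ₘ.antisym g≤ε
    (≤ₘ.trans (≤ₘ.reflexive (≈-sym gⁿ⁺¹≈ε))
              (≤ₘ.trans (stableˡ g (^ᵍ-≤ε g≤ε n)) (≤ₘ.reflexive (identityʳ g))))

  negative-isOrderIdeal : IsOrderIdeal M (_≤ₘ ε)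
  negative-isOrderIdeal x≤y y≤ε = ≤ₘ.trans x≤y y≤ε

-- Encoding inner products into the evaluation problem

weight : ∀ {n} → Vec Bool n → ℕ
weight []      = 0
weight (β ∷ α) = bit β + weight α

unary : ∀ {p} → Fin p → Vec Bool p
unary {suc p} zero    = replicate (suc p) false
unary         (suc u) = true ∷ unary u

weight-unary : ∀ {p} (u : Fin p) → weight (unary u) ≡ toℕ u
weight-unary {suc p} zero    = weight-false (suc p)
  where
  weight-false : ∀ n → weight (replicate n false) ≡ 0
  weight-false zero    = refl
  weight-false (suc n) = weight-false n
weight-unary         (suc u) = cong suc (weight-unary u)

module Encoding {c ℓ ℓ₂} (M : FiniteOrderedGroup c ℓ ℓ₂) (x y : FiniteOrderedGroup.Carrier M) where

  open FiniteOrderedGroup M renaming (refl to ≈-refl; sym to ≈-sym; trans to ≈-trans)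
  open GroupProperties group
  open import Algebra.Properties.Monoid.Mult monoid using (×-homo-+)
  open import Relation.Binary.Reasoning.Setoid setoid

  record Realises {n} (k : ℕ) (as bs : Vec Carrier n) : Set ℓ where
    constructor realises
    field
      product≈ : interleavedProduct M as bs ≈ commutator x y ^ᵍ k

  interleavedProduct-++ : ∀ {n n′} (as bs : Vec Carrier n) (as′ bs′ : Vec Carrier n′) →
    interleavedProduct M (as ++ as′) (bs ++ bs′) ≈ interleavedProduct M as bs ∙ interleavedProduct M as′ bs′
  interleavedProduct-++ []       []       as′ bs′ = ≈-sym (identityˡ _)
  interleavedProduct-++ (a ∷ as) (b ∷ bs) as′ bs′ =
    ≈-trans (∙-congˡ (interleavedProduct-++ as bs as′ bs′)) (≈-sym (assoc _ _ _))

  realises-++ : ∀ {k k′ n n′} {as bs : Vec Carrier n} {as′ bs′ : Vec Carrier n′} →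
    Realises k as bs → Realises k′ as′ bs′ → Realises (k + k′) (as ++ as′) (bs ++ bs′)
  realises-++ {k} {k′} {as = as} {bs} {as′} {bs′} (realises r) (realises r′) = realises (begin
    interleavedProduct M (as ++ as′) (bs ++ bs′)               ≈⟨ interleavedProduct-++ as bs as′ bs′ ⟩
    interleavedProduct M as bs ∙ interleavedProduct M as′ bs′  ≈⟨ ∙-cong r r′ ⟩
    commutator x y ^ᵍ k ∙ commutator x y ^ᵍ k′                 ≈⟨ ×-homo-+ _ k k′ ⟨
    commutator x y ^ᵍ (k + k′)                                 ∎)

  realises-cong : ∀ {k k′ n} {as bs : Vec Carrier n} → k ≡ k′ → Realises k as bs → Realises k′ as bs
  realises-cong refl r = r

  _^ᵇ_ : Carrier → Bool → Carrier
  g ^ᵇ false = ε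
  g ^ᵇ true  = g

  block : Carrier → Bool → Vec Carrier 2
  block g β = g ^ᵇ β ∷ (g ^ᵇ β) ⁻¹ ∷ []

  realises-block : ∀ β γ → Realises (bit (β ∧ γ)) (block x β) (block y γ)
  realises-block β γ = realises (≈-trans (∙-congˡ (identityʳ _)) (commutator-bits β γ))
    where
    commutator-bits : ∀ β γ → commutator (x ^ᵇ β) (y ^ᵇ γ) ≈ commutator x y ^ᵍ bit (β ∧ γ)
    commutator-bits false γ     = commutator-identityˡ (y ^ᵇ γ)
    commutator-bits true  false = commutator-identityʳ x
    commutator-bits true  true  = ≈-sym (identityʳ _)

  rowA : ∀ s → Bool → Vec Carrier (s * 2)
  rowA s β = concat (replicate s (block x β))

  rowB : ∀ {s} → Vec Bool s → Vec Carrier (s * 2)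
  rowB γs = concat (map (block y) γs)

  realises-row : ∀ β {s} (γs : Vec Bool s) → Realises (bit β * weight γs) (rowA s β) (rowB γs)
  realises-row β []       = realises-cong (sym (*-zeroʳ (bit β))) (realises ≈-refl)
  realises-row β (γ ∷ γs) = realises-cong
    (trans (cong (_+ bit β * weight γs) (bit-∧ β γ)) (sym (*-distribˡ-+ (bit β) (bit γ) (weight γs))))
    (realises-++ (realises-block β γ) (realises-row β γs))

  gridA : ∀ {r} s → Vec Bool r → Vec Carrier (r * (s * 2))
  gridA s α = concat (map (rowA s) α)

  gridB : ∀ r {s} → Vec Bool s → Vec Carrier (r * (s * 2))
  gridB r γs = concat (replicate r (rowB γs))

  realises-grid : ∀ {r s} (α : Vec Bool r) (γs : Vec Bool s) →
                  Realises (weight α * weight γs) (gridA s α) (gridB r γs)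
  realises-grid []      γs = realises ≈-refl
  realises-grid (β ∷ α) γs = realises-cong (sym (*-distribʳ-+ (weight γs) (bit β) (weight α)))
    (realises-++ (realises-row β γs) (realises-grid α γs))

  -- Coordinates are sent in unary, so that the grid of commutator blocks realises [x, y] ^ (u v).
  encodeA encodeB : ∀ {p m} → Vec (Fin p) m → Vec Carrier (m * (p * (p * 2)))
  encodeA {p} = concat ∘ map (gridA p ∘ unary)
  encodeB {p} = concat ∘ map (gridB p ∘ unary)

  realises-encode : ∀ {p m} (a b : Vec (Fin p) m) → Realises (dot a b) (encodeA a) (encodeB b)
  realises-encode []      []      = realises ≈-refl
  realises-encode (u ∷ a) (v ∷ b) = realises-++
    (realises-cong (cong₂ _*_ (weight-unary u) (weight-unary v)) (realises-grid (unary u) (unary v)))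
    (realises-encode a b)

  realises-repeat : ∀ t {k n} {as bs : Vec Carrier n} → Realises k as bs →
                    Realises (t * k) (concat (replicate t as)) (concat (replicate t bs))
  realises-repeat zero    r = realises ≈-refl
  realises-repeat (suc t) r = realises-++ r (realises-repeat t r)

  pad : ∀ {k n} → k ≤ n → Vec Carrier k → Vec Carrier n
  pad {n = n} z≤n  []       = replicate n ε
  pad         (s≤s k≤n) (g ∷ gs) = g ∷ pad k≤n gs

  interleavedProduct-pad : ∀ {l n} (l≤n : l ≤ n) (as bs : Vec Carrier l) →
                           interleavedProduct M (pad l≤n as) (pad l≤n bs) ≈ interleavedProduct M as bs
  interleavedProduct-pad {n = n} z≤n [] [] = product-ε n
    where
    product-ε : ∀ n → interleavedProduct M (replicate n ε) (replicate n ε) ≈ ε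
    product-ε zero    = ≈-refl
    product-ε (suc n) = ≈-trans (∙-cong (identityˡ ε) (product-ε n)) (identityˡ ε)
  interleavedProduct-pad (s≤s l≤n) (a ∷ as) (b ∷ bs) = ∙-congˡ (interleavedProduct-pad l≤n as bs)

  realises-pad : ∀ {k l n} (l≤n : l ≤ n) {as bs : Vec Carrier l} → Realises k as bs →
                 Realises k (pad l≤n as) (pad l≤n bs)
  realises-pad l≤n {as} {bs} (realises r) = realises (≈-trans (interleavedProduct-pad l≤n as bs) r)

private
  -- The surplus (2q − 1)⁴ − 4q⁴ is a polynomial in r = q − 2 with positive coefficients.
  4q⁴≤[2q-1]⁴ : ∀ r → 4 * (2 + r) ^ 4 ≤ (2 + r + (1 + r)) ^ 4
  4q⁴≤[2q-1]⁴ r = ≤-trans (m≤m+n _ (17 + r * (88 + r * (120 + r * (64 + r * 12))))) (≤-reflexive (expand r))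
    where
    expand : ∀ r → 4 * ((2 + r) * ((2 + r) * ((2 + r) * ((2 + r) * 1)))) + (17 + r * (88 + r * (120 + r * (64 + r * 12))))
                 ≡ (2 + r + (1 + r)) * ((2 + r + (1 + r)) * ((2 + r + (1 + r)) * ((2 + r + (1 + r)) * 1)))
    expand = solve-∀

  4^j*q⁴ʲ≤[2q-1]⁴ʲ : ∀ r j → 4 ^ j * ((2 + r) ^ 4) ^ j ≤ ((2 + r + (1 + r)) ^ 4) ^ j
  4^j*q⁴ʲ≤[2q-1]⁴ʲ r zero    = ≤-refl
  4^j*q⁴ʲ≤[2q-1]⁴ʲ r (suc j) = begin
    4 * 4 ^ j * ((2 + r) ^ 4 * ((2 + r) ^ 4) ^ j)    ≡⟨ interchange-* 4 (4 ^ j) ((2 + r) ^ 4) _ ⟩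
    4 * (2 + r) ^ 4 * (4 ^ j * ((2 + r) ^ 4) ^ j)    ≤⟨ *-mono-≤ (4q⁴≤[2q-1]⁴ r) (4^j*q⁴ʲ≤[2q-1]⁴ʲ r j) ⟩
    (2 + r + (1 + r)) ^ 4 * ((2 + r + (1 + r)) ^ 4) ^ j ∎
    where
    open ≤-Reasoning
    interchange-* : ∀ a b c d → a * b * (c * d) ≡ a * c * (b * d)
    interchange-* = solve-∀

4^-cancel-≤ : ∀ {j K} → 4 ^ j ≤ 4 ^ K → j ≤ K
4^-cancel-≤ 4ʲ≤4ᴷ = ≮⇒≥ (λ K<j → <⇒≱ (^-monoʳ-< 4 (s≤s (s≤s z≤n)) K<j) 4ʲ≤4ᴷ)

disjoint-growth : ∀ {p} → Prime p → ∀ j K →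
  sumVec (4 * j) (λ a → count (4 * j) (disjoint {p} a)) ≤ 4 ^ K * p ^ (4 * j) → j ≤ K
disjoint-growth {0}           p-prime = ⊥-elim (¬prime[0] p-prime)
disjoint-growth {1}           p-prime = ⊥-elim (¬prime[1] p-prime)
disjoint-growth {suc (suc r)} p-prime j K count≤ =
  4^-cancel-≤ (*-cancelʳ-≤ (4 ^ j) (4 ^ K) (p ^ (4 * j)) {{m^n≢0 p (4 * j)}} (begin
  4 ^ j * p ^ (4 * j)                  ≡⟨ cong (4 ^ j *_) (^-*-assoc p 4 j) ⟨
  4 ^ j * (p ^ 4) ^ j                  ≤⟨ 4^j*q⁴ʲ≤[2q-1]⁴ʲ r j ⟩
  ((p + suc r) ^ 4) ^ j                ≡⟨ ^-*-assoc (p + suc r) 4 j ⟩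
  (p + suc r) ^ (4 * j)                ≡⟨ count-disjoint (4 * j) ⟨
  sumVec (4 * j) (λ a → count (4 * j) (disjoint a)) ≤⟨ count≤ ⟩
  4 ^ K * p ^ (4 * j)                  ∎))
  where
  open ≤-Reasoning
  p = suc (suc r)

n≤A*[n/A∸1]+2A : ∀ n A .{{_ : NonZero A}} → n ≤ A * (n / A ∸ 1) + 2 * A
n≤A*[n/A∸1]+2A n A = begin
  n                         ≡⟨ m≡m%n+[m/n]*n n A ⟩
  n % A + n / A * A         ≤⟨ +-mono-≤ (<⇒≤ (m%n<n n A)) (*-monoˡ-≤ A (m≤n+m∸n (n / A) 1)) ⟩
  A + (1 + (n / A ∸ 1)) * A ≡⟨ rearrange A (n / A ∸ 1) ⟩
  A * (n / A ∸ 1) + 2 * A   ∎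
  where
  open ≤-Reasoning
  rearrange : ∀ A k → A + (1 + k) * A ≡ A * k + 2 * A
  rearrange = solve-∀

-- With p t ≤ e, a coordinate takes t · p · 2p ≤ 2e² letters, so n / scale e blocks of four
-- coordinates fit into length n.
scale : ℕ → ℕ
scale e = 4 * (e * (e * 2))

instance
  scale-suc≢0 : ∀ {e} → NonZero (scale (suc e))
  scale-suc≢0 = _

encoding-fits : ∀ {p t e} n → p * t ≤ suc e → p ≤ suc e →
                t * (4 * (n / scale (suc e)) * (p * (p * 2))) ≤ n
encoding-fits {p} {t} {e} n pt≤e p≤e = begin
  t * (4 * j * (p * (p * 2)))        ≡⟨ regroup t j p ⟩
  4 * j * (p * t * (p * 2))          ≤⟨ *-monoʳ-≤ (4 * j) (*-mono-≤ pt≤e (*-monoˡ-≤ 2 p≤e)) ⟩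
  4 * j * (suc e * (suc e * 2))      ≡⟨ regroup′ j (suc e * (suc e * 2)) ⟩
  j * scale (suc e)                  ≤⟨ m/n*n≤m n (scale (suc e)) ⟩
  n                                  ∎
  where
  open ≤-Reasoning
  j = n / scale (suc e)
  regroup : ∀ t j p → t * (4 * j * (p * (p * 2))) ≡ 4 * j * (p * t * (p * 2))
  regroup = solve-∀
  regroup′ : ∀ j W → 4 * j * W ≡ j * (4 * W)
  regroup′ = solve-∀

module LowerBound {c ℓ ℓ₂} (M : FiniteOrderedGroup c ℓ ℓ₂) where

  open FiniteOrderedGroup M renaming (refl to ≈-refl; sym to ≈-sym; trans to ≈-trans)
  open GroupProperties group
  open FiniteOrderedGroupProperties M
  open import Algebra.Properties.Monoid.Mult monoid using (×-assocˡ)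
  private module ≤ₘ = IsPartialOrder isPartialOrder

  Accepted : ∀ n → Vec Carrier n → Vec Carrier n → Set ℓ₂
  Accepted = EvalProblem M (_≤ₘ ε)

  module Reduction {x y : Carrier} {e : ℕ} (po : PrimeOrderPower (commutator x y) e)
                   {n m : ℕ} (fits : PrimeOrderPower.t po * (m * (PrimeOrderPower.p po * (PrimeOrderPower.p po * 2))) ≤ n)
                   where

    open PrimeOrderPower po
    open Encoding M x y

    inputA inputB : Vec (Fin p) m → Vec Carrier n
    inputA a = pad fits (concat (replicate t (encodeA a)))
    inputB b = pad fits (concat (replicate t (encodeB b)))

    product-inputs : ∀ a b → interleavedProduct M (inputA a) (inputB b) ≈ (commutator x y ^ᵍ t) ^ᵍ dot a b
    product-inputs a b = ≈-trans (Realises.product≈ (realises-pad fits (realises-repeat t (realises-encode a b))))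
      (≈-trans (reflexive (cong (commutator x y ^ᵍ_) (*-comm t (dot a b)))) (≈-sym (×-assocˡ _ (dot a b) t)))

    disjoint⇒accepted : ∀ a b → T (disjoint a b) → Accepted n (inputA a) (inputB b)
    disjoint⇒accepted a b d = ≤ₘ.reflexive
      (≈-trans (product-inputs a b) (reflexive (cong ((commutator x y ^ᵍ t) ^ᵍ_) (dot-disjoint a b d))))

    accepted⇒orthogonal : ∀ a b → Accepted n (inputA a) (inputB b) → p ∣ dot a b
    accepted⇒orthogonal a b acc =
      prime-order-∣ p-prime nontrivial order (≈-trans (≈-sym (product-inputs a b)) (≤ε⇒≈ε acc))

    module _ (P : NDProtocol (Vec Carrier n) (Vec Carrier n)) (computes : Computes P (Accepted n))
             (k : ℕ) (cost : CostAtMost P (Accepted n) k) where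

      certificate : ∀ a b → T (disjoint a b) → List Bool
      certificate a b d = proj₁ (cost (inputA a) (inputB b) (disjoint⇒accepted a b d))

      labelWith : ∀ a b → Dec (T (disjoint a b)) → ℕ
      labelWith a b (yes d) = code (pair s (trace (P s) (inputA a) (inputB b)))
        where s = certificate a b d
      labelWith a b (no _)  = 0

      labelWith-< : ∀ a b d? → T (disjoint a b) → labelWith a b d? < 4 ^ suc k
      labelWith-< a b (no ¬d) d = ⊥-elim (¬d d)
      labelWith-< a b (yes d) _ = begin-strict
        code (pair s τ)                          <⟨ code<2^ (pair s τ) ⟩
        2 ^ suc (length (pair s τ))              ≤⟨ ^-monoʳ-≤ 2 (s≤s (length-pair s τ)) ⟩
        2 ^ suc (suc (2 * (length s + length τ))) ≡⟨ cong (2 ^_) (*-suc 2 (length s + length τ)) ⟨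
        2 ^ (2 * suc (length s + length τ))      ≤⟨ ^-monoʳ-≤ 2 (*-monoʳ-≤ 2 (s≤s s+τ≤k)) ⟩
        2 ^ (2 * suc k)                          ≡⟨ ^-*-assoc 2 2 (suc k) ⟨
        4 ^ suc k                                ∎
        where
        open ≤-Reasoning
        s = certificate a b d
        τ = trace (P s) (inputA a) (inputB b)
        s+τ≤k : length s + length τ ≤ k
        s+τ≤k = subst (λ l → length s + l ≤ k) (sym (length-trace (P s) (inputA a) (inputB b)))
                      (proj₂ (proj₂ (cost (inputA a) (inputB b) (disjoint⇒accepted a b d))))

      -- Equal labels mean a common certificate and transcript, so P also accepts the crossed input.
      labelWith-rectangle : ∀ a b₁ a₂ b d₁? d₂? → T (disjoint a b₁) → T (disjoint a₂ b) →
                            labelWith a b₁ d₁? ≡ labelWith a₂ b d₂? → p ∣ dot a b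
      labelWith-rectangle a b₁ a₂ b (no ¬d₁) _        d₁ _  _ = ⊥-elim (¬d₁ d₁)
      labelWith-rectangle a b₁ a₂ b (yes _)  (no ¬d₂) _  d₂ _ = ⊥-elim (¬d₂ d₂)
      labelWith-rectangle a b₁ a₂ b (yes d₁) (yes d₂) _  _  same = Dec.decidable-stable (p ∣? dot a b)
        (λ p∤ → proj₂ computes (inputA a) (inputB b) (p∤ ∘ accepted⇒orthogonal a b) s₁ accepts)
        where
        s₁ = certificate a b₁ d₁
        s₂ = certificate a₂ b d₂
        τ₁ = trace (P s₁) (inputA a) (inputB b₁)
        τ₂ = trace (P s₂) (inputA a₂) (inputB b)
        s₁≡s₂×τ₁≡τ₂ : s₁ ≡ s₂ × τ₁ ≡ τ₂
        s₁≡s₂×τ₁≡τ₂ = pair-injective s₁ τ₁ s₂ τ₂ (code-injective (pair s₁ τ₁) (pair s₂ τ₂) same)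
        accepts : Accepts P (inputA a) (inputB b) s₁
        accepts = trans
          (output-rectangle (P s₁)
             (trans (proj₂ s₁≡s₂×τ₁≡τ₂) (cong (λ s → trace (P s) (inputA a₂) (inputB b)) (sym (proj₁ s₁≡s₂×τ₁≡τ₂)))))
          (proj₁ (proj₂ (cost (inputA a) (inputB b₁) (disjoint⇒accepted a b₁ d₁))))

      protocol-bound : sumVec m (λ a → count m (disjoint a)) ≤ 4 ^ suc k * p ^ m
      protocol-bound = cover-bound p-prime m (4 ^ suc k) (λ a b → labelWith a b (T? (disjoint a b)))
        (λ a b → labelWith-< a b (T? (disjoint a b)))
        (λ a b₁ a₂ b → labelWith-rectangle a b₁ a₂ b (T? (disjoint a b₁)) (T? (disjoint a₂ b)))

  cost-lower-bound : ∀ {x y e} → PrimeOrderPower (commutator x y) (suc e) →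
                     ∀ {n} P → Computes P (Accepted n) → ∀ k → CostAtMost P (Accepted n) k →
                     n / scale (suc e) ≤ suc k
  cost-lower-bound {e = e} po {n} P computes k cost =
    disjoint-growth p-prime (n / scale (suc e)) (suc k)
      (Reduction.protocol-bound po {n} {4 * (n / scale (suc e))} (encoding-fits n pt≤e (≤-trans (m≤m*n p t) pt≤e))
         P computes k cost)
    where
    open PrimeOrderPower po
    instance
      t≢0 : NonZero t
      t≢0 = ≢-nonZero (λ t≡0 → nontrivial (reflexive (cong (_ ^ᵍ_) t≡0)))
    pt≤e : p * t ≤ suc e
    pt≤e = ∣⇒≤ pt∣e

lemma4p14 : ∀ {c ℓ ℓ₂} (M : FiniteOrderedGroup c ℓ ℓ₂) →
    NonCommutative (FiniteOrderedGroup.group M) →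
    ∃[ a ] ∃[ d ] (∀ (n : ℕ) → ∃[ k ] (N¹-atLeast M n k × n ≤ a * k + d))
lemma4p14 M (x , y , x∙y≉y∙x) = linear (finite-order (commutator x y))
  where
  open FiniteOrderedGroup M
  open GroupProperties group
  open FiniteOrderedGroupProperties M
  open LowerBound M

  linear : ∃[ e ] (0 < e × commutator x y ^ᵍ e ≈ ε) →
           ∃[ a ] ∃[ d ] (∀ (n : ℕ) → ∃[ k ] (N¹-atLeast M n k × n ≤ a * k + d))
  linear (suc e , _ , [x,y]ᵉ≈ε) = scale (suc e) , 2 * scale (suc e) , λ n →
    n / scale (suc e) ∸ 1 , (_≤ₘ ε , negative-isOrderIdeal , lower-bound n) , n≤A*[n/A∸1]+2A n (scale (suc e))
    where
    lower-bound : ∀ n P → Computes P (Accepted n) → ∀ k → CostAtMost P (Accepted n) k → n / scale (suc e) ∸ 1 ≤ k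
    lower-bound n P computes k cost = Dec.decidable-stable (n / scale (suc e) ∸ 1 ≤? k) λ ≰k →
      ¬¬primeOrderPower (x∙y≉y∙x ∘ commutator≈ε⇒comm x y) [x,y]ᵉ≈ε
        (λ po → ≰k (∸-monoˡ-≤ 1 (cost-lower-bound {e = e} po P computes k cost)))
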